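{- Let $k\ge 6$ be an integer, let $G^\star$ be a $k$-weak graph with associated graph $G$, let $T$ be a subgraph of $G$, and let $M$ be a component of $G-V(T)$ with $|V(M)|\ge 3$. Let $B_M$ and $u_M$ be chosen as described in the context. If $\deg_T(u_M)\le k-2$, then for every vertex $w\in V(M)\setminus\{u_M\}$, the pair $(u_M,w)$ is $(k-\deg_T(u_M))$-valid in $M$.
   Context: For $k\ge 3$, $G^\star$ is $k$-weak if either (Type I) $G^\star$ is 3-connected and its second smallest degree is at least $k$, in which case $\theta$ denotes a fixed vertex of minimum degree and $G:=G^\star$; or (Type II) there is exactly one vertex $\theta$ with $\deg(\theta)=2$, with neighbours $\theta_1,\theta_2$, such that $G^\star-\theta$ plus the edge $\theta_1\theta_2$ is 3-connected with minimum degree at least $k$, in which case $G:=G^\star-\theta$. A block of a connected graph $M$ is a maximal connected subgraph without a cut-vertex of its own; an end-block is a block containing at most one cut-vertex of $M$; $\mathrm{Cut}(B)$ is the set of cut-vertices of $M$ lying in the block $B$. $\deg_T(v)$ is the number of neighbours of $v$ in $V(T)$ (in $G$), $\deg_B(v)$ the degree of $v$ in $B$. Choice of $B_M$: if $M$ is 2-connected, $B_M:=M$; if $M$ is not 2-connected and $G^\star$ is of Type I, $B_M$ is any end-block of $M$ with $\theta\notin V(B_M)\setminus\mathrm{Cut}(B_M)$; if $M$ is not 2-connected and $G^\star$ is of Type II, $B_M$ is an end-block of $M$ of maximum order among those for which $V(B_M)\setminus\mathrm{Cut}(B_M)$ contains at most one of $\theta_1,\theta_2$. Choice of $u_M$: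 a vertex of $V(B_M)\setminus\mathrm{Cut}(B_M)$ maximizing $\deg_T$ over this set and, subject to this, minimizing $\deg_G$. For distinct vertices $x,y$ of a connected graph $M$ and an integer $t\ge2$, the ordered pair $(x,y)$ is $t$-valid if there is an end-block $B$ of $M$ with $|V(B)|\ge t$ such that either (1) $x,y\in V(B)$ and $\deg_B(v)\ge t$ for all but at most one vertex $v\in V(B)\setminus\{x,y\}$; or (2) $\mathrm{Cut}(B)=\{b\}$, $x\in V(B)\setminus\{b\}$, $y\notin V(B)$, and $\deg_B(v)\ge t$ for all but at most one $v\in V(B)\setminus\{x,b\}$. -}

module Defs where

open import Data.Nat using (ℕ; zero; suc; _+_; _≤_; _<_)
open import Data.Fin using (Fin; zero; suc; _≟_)
open import Data.Bool using (Bool; true; false; T; _∧_; _∨_; not; if_then_else_)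
open import Data.Product using (Σ; ∃; _×_; _,_)
open import Data.Sum using (_⊎_)
open import Relation.Nullary using (¬_; does)
open import Relation.Binary.PropositionalEquality using (_≡_; _≢_)

-- A graph is given by its vertex set (a Bool predicate on Fin n) and
-- its edge relation (a Bool relation on Fin n); well-formedness
-- (simple, undirected, edges between vertices) is the predicate WF.

record SG (n : ℕ) : Set where
  field
    vs : Fin n → Bool
    es : Fin n → Fin n → Bool
open SG public

countF : ∀ {n} → (Fin n → Bool) → ℕ
countF {zero}  f = 0
countF {suc n} f = (if f zero then 1 else 0) + countF (λ i → f (suc i))

module _ {n : ℕ} where

  WF : SG n → Set
  WF H = (∀ u v → T (es H u v) → T (es H v u))
       × (∀ u → ¬ T (es H u u))
       × (∀ u v → T (es H u v) → T (vs H u) × T (vs H v))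

  _⊆_ : SG n → SG n → Set
  H ⊆ K = (∀ v → T (vs H v) → T (vs K v)) × (∀ u v → T (es H u v) → T (es K u v))

  IsSubgraph : SG n → SG n → Set
  IsSubgraph H K = WF H × H ⊆ K

  _≅_ : SG n → SG n → Set
  H ≅ K = H ⊆ K × K ⊆ H

  order : SG n → ℕ
  order H = countF (vs H)

  deg : SG n → Fin n → ℕ
  deg H v = countF (es H v)

  degT : SG n → SG n → Fin n → ℕ
  degT G Tg v = countF (λ x → es G v x ∧ vs Tg x)

  delSet : SG n → (Fin n → Bool) → SG n
  delSet H X = record
    { vs = λ v → vs H v ∧ not (X v)
    ; es = λ u v → es H u v ∧ (not (X u) ∧ not (X v)) }

  delV : SG n → Fin n → SG n
  delV H v = delSet H (λ u → does (u ≟ v))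

  addEdge : SG n → Fin n → Fin n → SG n
  addEdge H a b = record
    { vs = vs H
    ; es = λ u v → es H u v ∨ ((does (u ≟ a) ∧ does (v ≟ b)) ∨ (does (u ≟ b) ∧ does (v ≟ a))) }

  data Walk (H : SG n) : Fin n → Fin n → Set where
    []  : ∀ {x} → T (vs H x) → Walk H x x
    _∷_ : ∀ {x y z} → T (es H x y) → Walk H y z → Walk H x z

  Connected : SG n → Set
  Connected H = (∃ λ v → T (vs H v))
              × (∀ x y → T (vs H x) → T (vs H y) → Walk H x y)

  KConnected : ℕ → SG n → Set
  KConnected k H = (k < order H) × (∀ (X : Fin n → Bool) → countF X < k → Connected (delSet H X))

  MinDeg≥ : ℕ → SG n → Set
  MinDeg≥ k H = ∀ v → T (vs H v) → k ≤ deg H v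

  -- second smallest degree at least k: of any two distinct vertices,
  -- at least one has degree ≥ k
  SecondSmallestDeg≥ : ℕ → SG n → Set
  SecondSmallestDeg≥ k H = ∀ u v → T (vs H u) → T (vs H v) → u ≢ v → (k ≤ deg H u) ⊎ (k ≤ deg H v)

  -- v is a cut-vertex of H: removing v separates two vertices that were
  -- connected in H (i.e. the number of components increases)
  IsCutVertex : SG n → Fin n → Set
  IsCutVertex H v = T (vs H v) × (∃ λ x → ∃ λ y →
      T (vs H x) × T (vs H y) × x ≢ v × y ≢ v × Walk H x y × ¬ Walk (delV H v) x y)

  IsComponent : SG n → SG n → Set
  IsComponent D M = IsSubgraph M D × Connected M
    × (∀ M' → IsSubgraph M' D → Connected M' → M ⊆ M' → M' ⊆ M)

  NoCutVertex : SG n → Set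
  NoCutVertex B = ∀ v → ¬ IsCutVertex B v

  IsBlock : SG n → SG n → Set
  IsBlock M B = IsSubgraph B M × Connected B × NoCutVertex B
    × (∀ B' → IsSubgraph B' M → Connected B' → NoCutVertex B' → B ⊆ B' → B' ⊆ B)

  IsEndBlock : SG n → SG n → Set
  IsEndBlock M B = IsBlock M B
    × (∀ a b → T (vs B a) → IsCutVertex M a → T (vs B b) → IsCutVertex M b → a ≡ b)

  -- v ∈ V(B) \ Cut(B)   (Cut(B) = cut-vertices of M lying in B)
  Interior : SG n → SG n → Fin n → Set
  Interior M B v = T (vs B v) × ¬ IsCutVertex M v

  AllButOne : (Fin n → Set) → (Fin n → Set) → Set
  AllButOne P Q = ∃ λ e → ∀ v → P v → v ≢ e → Q v

  Valid : ℕ → SG n → Fin n → Fin n → Set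
  Valid t M x y = ∃ λ B → IsEndBlock M B × t ≤ order B ×
    ( ( T (vs B x) × T (vs B y)
      × AllButOne (λ v → T (vs B v) × v ≢ x × v ≢ y) (λ v → t ≤ deg B v) )
    ⊎ ( ∃ λ b → (T (vs B b) × IsCutVertex M b
                 × (∀ c → T (vs B c) → IsCutVertex M c → c ≡ b))
        × T (vs B x) × x ≢ b × ¬ T (vs B y)
        × AllButOne (λ v → T (vs B v) × v ≢ x × v ≢ b) (λ v → t ≤ deg B v) ) )

  -- G* is k-weak with associated graph G (the constructor records the type
  -- and the distinguished vertices θ, resp. θ, θ₁, θ₂)
  data KWeak (k : ℕ) (Gs : SG n) : SG n → Set where
    typeI : (θ : Fin n)
      → KConnected 3 Gs
      → SecondSmallestDeg≥ k Gs
      → T (vs Gs θ)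
      → (∀ v → T (vs Gs v) → deg Gs θ ≤ deg Gs v)
      → KWeak k Gs Gs
    typeII : (θ θ₁ θ₂ : Fin n)
      → T (vs Gs θ)
      → deg Gs θ ≡ 2
      → (∀ v → T (vs Gs v) → deg Gs v ≡ 2 → v ≡ θ)
      → θ₁ ≢ θ₂
      → T (es Gs θ θ₁)
      → T (es Gs θ θ₂)
      → KConnected 3 (addEdge (delV Gs θ) θ₁ θ₂)
      → MinDeg≥ k (addEdge (delV Gs θ) θ₁ θ₂)
      → KWeak k Gs (delV Gs θ)

  EligibleII : Fin n → Fin n → SG n → SG n → Set
  EligibleII θ₁ θ₂ M B = IsEndBlock M B × ¬ (Interior M B θ₁ × Interior M B θ₂)

  BMChoice : ∀ {k Gs G} → KWeak k Gs G → SG n → SG n → Set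
  BMChoice w M B = (KConnected 2 M × B ≅ M) ⊎ (¬ KConnected 2 M × BMRest w)
    where
    BMRest : ∀ {k Gs G} → KWeak k Gs G → Set
    BMRest (typeI θ _ _ _ _) = IsEndBlock M B × ¬ Interior M B θ
    BMRest (typeII θ θ₁ θ₂ _ _ _ _ _ _ _ _) =
      EligibleII θ₁ θ₂ M B × (∀ B' → EligibleII θ₁ θ₂ M B' → order B' ≤ order B)

  UMChoice : SG n → SG n → SG n → SG n → Fin n → Set
  UMChoice G Tg M B u = Interior M B u
    × (∀ v → Interior M B v → degT G Tg v ≤ degT G Tg u)
    × (∀ v → Interior M B v → degT G Tg v ≡ degT G Tg u → deg G u ≤ deg G v)

{-# OPTIONS --safe #-}
module Submission where

-- For v in the component M, deg_G v = deg_T v + deg_M v, and a vertex of B = B_M that is not a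
-- cut-vertex of M keeps all its M-edges in B: such an edge, closed up by a path back to B, would
-- extend B to a larger block. As u = u_M maximises deg_T over these vertices, each of them with
-- deg_G ≥ k has deg_B ≥ k − deg_T u = t. Only θ (Type I), resp. θ₁, θ₂ (Type II), can have smaller
-- G-degree; in Type II such a deficient vertex still has degree ≥ k − 1 in G, which forces its
-- deg_T to equal deg_T u, and then the tie-break puts u among θ₁, θ₂ too. The choice of B_M thus
-- leaves at most one deficient vertex besides u: the exceptional one if M is 2-connected, and
-- otherwise only the cut-vertex of the end-block. If w lies outside B, a u–w walk leaves B
-- through that cut-vertex.

open import Defs
open import Data.Nat using (ℕ; zero; suc; _+_; _≤_; _<_; _∸_; z≤n; s≤s; _≤?_)
open import Data.Nat.Properties
  using (≤-refl; ≤-trans; ≤-antisym; ≤-reflexive; ≤-<-trans; <⇒≱; ≰⇒>; m≤n⇒m≤1+n; m<m+n; m∸n≤m;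
         m+[n∸m]≡n; +-comm; +-suc; +-mono-≤; +-monoˡ-≤; +-monoʳ-≤; +-mono-≤-<; +-cancelˡ-≤; +-cancelʳ-≤;
         +-commutativeSemigroup; module ≤-Reasoning)
open import Algebra.Properties.CommutativeSemigroup +-commutativeSemigroup using (interchange; x∙yz≈y∙xz)
open import Data.Fin using (Fin; zero; suc; _≟_)
open import Data.Fin.Properties using (any?)
open import Data.Bool using (Bool; true; false; T; _∧_; _∨_; not; if_then_else_)
open import Data.Bool.Properties using (T-∧; T-∨)
open import Data.Product using (Σ; ∃₂; _×_; _,_; proj₁; proj₂)
open import Data.Sum using (_⊎_; inj₁; inj₂; [_,_]; [_,_]′)
import Data.Sum as Sum
open import Data.Empty using (⊥-elim)
open import Data.Unit using (⊤; tt)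
open import Function using (id; _∘_)
open import Function.Bundles using (Equivalence)
open import Relation.Nullary using (¬_; Dec; yes; no; does)
open import Relation.Nullary.Decidable using (T?; ¬?; _×-dec_; decidable-stable)
open import Relation.Nullary.Negation using (¬¬-map)
open import Relation.Unary using (Decidable)
open import Relation.Binary.PropositionalEquality using (_≡_; _≢_; refl; sym; trans; cong; cong₂; subst)

open Equivalence using (to; from)

private variable
  n : ℕ

fromDoes : ∀ {P : Set} (d : Dec P) → T (does d) → P
fromDoes (yes p) _ = p

toDoes : ∀ {P : Set} (d : Dec P) → P → T (does d)
toDoes (yes _) _ = tt
toDoes (no ¬p) p = ¬p p

≟-refl : (x : Fin n) → T (does (x ≟ x))
≟-refl x = toDoes (x ≟ x) refl

T-not⇒¬T : ∀ b → T (not b) → ¬ T b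
T-not⇒¬T false _ ()

¬T⇒T-not : ∀ b → ¬ T b → T (not b)
¬T⇒T-not false _ = tt
¬T⇒T-not true ¬t = ¬t tt

-- Counting

indicator-mono : ∀ a b → (T a → T b) → (if a then 1 else 0) ≤ (if b then 1 else 0)
indicator-mono false _ _ = z≤n
indicator-mono true true _ = ≤-refl
indicator-mono true false a⇒b = ⊥-elim (a⇒b tt)

indicator-split : ∀ a b → (if a then 1 else 0) ≡ (if a ∧ b then 1 else 0) + (if a ∧ not b then 1 else 0)
indicator-split false _ = refl
indicator-split true true = refl
indicator-split true false = refl

countF-mono : (f g : Fin n → Bool) → (∀ i → T (f i) → T (g i)) → countF f ≤ countF g
countF-mono {zero} f g f⇒g = z≤n
countF-mono {suc n} f g f⇒g =
  +-mono-≤ (indicator-mono (f zero) (g zero) (f⇒g zero)) (countF-mono _ _ (λ i → f⇒g (suc i)))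

countF-cong : (f g : Fin n → Bool) → (∀ i → T (f i) → T (g i)) → (∀ i → T (g i) → T (f i))
  → countF f ≡ countF g
countF-cong f g f⇒g g⇒f = ≤-antisym (countF-mono f g f⇒g) (countF-mono g f g⇒f)

countF-false : countF {n} (λ _ → false) ≡ 0
countF-false {zero} = refl
countF-false {suc n} = countF-false {n}

countF-≟ : (c : Fin n) → countF (λ i → does (i ≟ c)) ≡ 1
countF-≟ {suc n} zero = cong suc (countF-false {n})
countF-≟ (suc c) = countF-≟ c

countF-≤1 : (f : Fin n → Bool) (c : Fin n) → (∀ i → T (f i) → i ≡ c) → countF f ≤ 1
countF-≤1 f c only-c =
  ≤-trans (countF-mono f _ (λ i fi → toDoes (i ≟ c) (only-c i fi))) (≤-reflexive (countF-≟ c))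

countF-split : (f g : Fin n → Bool)
  → countF f ≡ countF (λ i → f i ∧ g i) + countF (λ i → f i ∧ not (g i))
countF-split {zero} f g = refl
countF-split {suc n} f g =
  trans (cong₂ _+_ (indicator-split (f zero) (g zero)) (countF-split f′ g′))
        (interchange (if f zero ∧ g zero then 1 else 0) (if f zero ∧ not (g zero) then 1 else 0)
                     (countF (λ i → f′ i ∧ g′ i)) (countF (λ i → f′ i ∧ not (g′ i))))
  where
  f′ g′ : Fin n → Bool
  f′ i = f (suc i)
  g′ i = g (suc i)

countF-∨ : (f g : Fin n → Bool) → countF (λ i → f i ∨ g i) ≤ countF f + countF g
countF-∨ f g = begin
  countF (λ i → f i ∨ g i)
    ≡⟨ countF-split _ f ⟩
  countF (λ i → (f i ∨ g i) ∧ f i) + countF (λ i → (f i ∨ g i) ∧ not (f i))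
    ≤⟨ +-mono-≤ (countF-mono _ f (λ _ → proj₂ ∘ to T-∧)) (countF-mono _ g only-g) ⟩
  countF f + countF g
    ∎
  where
  open ≤-Reasoning
  only-g : ∀ i → T ((f i ∨ g i) ∧ not (f i)) → T (g i)
  only-g i p with to T-∧ p
  ... | f∨g , ¬f = [ (λ fi → ⊥-elim (T-not⇒¬T (f i) ¬f fi)) , id ] (to T-∨ f∨g)

countF-< : (f g : Fin n → Bool) → (∀ i → T (f i) → T (g i)) → ∀ c → T (g c) → ¬ T (f c)
  → countF f < countF g
countF-< f g f⇒g c gc ¬fc = begin-strict
  countF f
    ≡⟨ countF-cong f _ (λ i fi → from T-∧ (f⇒g i fi , fi)) (λ _ → proj₂ ∘ to T-∧) ⟩
  countF (λ i → g i ∧ f i)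
    <⟨ m<m+n _ c-counted ⟩
  countF (λ i → g i ∧ f i) + countF (λ i → g i ∧ not (f i))
    ≡⟨ sym (countF-split g f) ⟩
  countF g
    ∎
  where
  open ≤-Reasoning
  c-counted : 0 < countF (λ i → g i ∧ not (f i))
  c-counted = ≤-trans (≤-reflexive (sym (countF-≟ c))) (countF-mono _ _ λ i i≟c →
    subst (λ j → T (g j ∧ not (f j))) (sym (fromDoes (i ≟ c) i≟c)) (from T-∧ (gc , ¬T⇒T-not (f c) ¬fc)))

deg<order : (H : SG n) → WF H → ∀ {v} → T (vs H v) → deg H v < order H
deg<order H (_ , irreflexive , ends) {v} v∈H =
  countF-< (es H v) (vs H) (λ w e → proj₂ (ends v w e)) v v∈H (irreflexive v)

-- Subgraphs, unions and walks

⊆-refl : {H : SG n} → H ⊆ H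
⊆-refl = (λ _ p → p) , (λ _ _ p → p)

⊆-trans : {H K L : SG n} → H ⊆ K → K ⊆ L → H ⊆ L
⊆-trans (hv , he) (kv , ke) = (λ v p → kv v (hv v p)) , (λ a b p → ke a b (he a b p))

WF-≅ : {H K : SG n} → H ≅ K → WF K → WF H
WF-≅ ((hv , he) , (kv , ke)) (symmetric , irreflexive , ends) =
  (λ a b e → ke b a (symmetric a b (he a b e))) ,
  (λ a e → irreflexive a (he a a e)) ,
  (λ a b e → let (a∈ , b∈) = ends a b (he a b e) in kv a a∈ , kv b b∈)

edge-≢ : {H : SG n} → WF H → ∀ {a b} → T (es H a b) → a ≢ b
edge-≢ (_ , irreflexive , _) {a} e refl = irreflexive a e

edge-target∈ : {H : SG n} → WF H → ∀ {a b} → T (es H a b) → T (vs H b)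
edge-target∈ (_ , _ , ends) e = proj₂ (ends _ _ e)

delSet-⊆ : (H : SG n) (X : Fin n → Bool) → delSet H X ⊆ H
delSet-⊆ H X = (λ _ → proj₁ ∘ to T-∧) , (λ _ _ → proj₁ ∘ to T-∧)

delSet-mono : {H K : SG n} (X : Fin n → Bool) → H ⊆ K → delSet H X ⊆ delSet K X
delSet-mono X (hv , he) =
  (λ v p → let (v∈ , v∉X) = to T-∧ p in from T-∧ (hv v v∈ , v∉X)) ,
  (λ a b p → let (e , ends∉X) = to T-∧ p in from T-∧ (he a b e , ends∉X))

WF-delSet : {H : SG n} (X : Fin n → Bool) → WF H → WF (delSet H X)
WF-delSet {H = H} X (symmetric , irreflexive , ends) =
  (λ a b p → let (e , a∉ , b∉) = split a b p in from T-∧ (symmetric a b e , from T-∧ (b∉ , a∉))) ,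
  (λ a p → irreflexive a (proj₁ (to T-∧ p))) ,
  (λ a b p → let (e , a∉ , b∉) = split a b p ; (a∈ , b∈) = ends a b e in
               from T-∧ (a∈ , a∉) , from T-∧ (b∈ , b∉))
  where
  split : ∀ a b → T (es (delSet H X) a b) → T (es H a b) × T (not (X a)) × T (not (X b))
  split a b p = let (e , q) = to T-∧ p in e , to T-∧ q

delV-∈ : (H : SG n) {a c : Fin n} → T (vs H a) → a ≢ c → T (vs (delV H c) a)
delV-∈ H {a} {c} a∈ a≢c = from T-∧ (a∈ , toDoes (¬? (a ≟ c)) a≢c)

delV-≢ : (H : SG n) {a c : Fin n} → T (vs (delV H c) a) → a ≢ c
delV-≢ H {a} {c} p = fromDoes (¬? (a ≟ c)) (proj₂ (to T-∧ p))

delV-edge : (H : SG n) {a b c : Fin n} → T (es H a b) → a ≢ c → b ≢ c → T (es (delV H c) a b)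
delV-edge H {a} {b} {c} e a≢c b≢c = from T-∧ (e , from T-∧ (toDoes (¬? (a ≟ c)) a≢c , toDoes (¬? (b ≟ c)) b≢c))

⊆-delV : {H : SG n} {c : Fin n} → WF H → ¬ T (vs H c) → H ⊆ delV H c
⊆-delV {H = H} (_ , _ , ends) c∉ =
  (λ v v∈ → delV-∈ H v∈ (≢c v∈)) ,
  (λ a b e → let (a∈ , b∈) = ends a b e in delV-edge H e (≢c a∈) (≢c b∈))
  where
  ≢c : ∀ {v} → T (vs H v) → v ≢ _
  ≢c v∈ refl = c∉ v∈

infixl 25 _∪_

_∪_ : SG n → SG n → SG n
H ∪ K = record { vs = λ v → vs H v ∨ vs K v ; es = λ a b → es H a b ∨ es K a b }

∪-⊆ˡ : (H K : SG n) → H ⊆ H ∪ K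
∪-⊆ˡ H K = (λ _ p → from T-∨ (inj₁ p)) , (λ _ _ p → from T-∨ (inj₁ p))

∪-⊆ʳ : (H K : SG n) → K ⊆ H ∪ K
∪-⊆ʳ H K = (λ _ p → from T-∨ (inj₂ p)) , (λ _ _ p → from T-∨ (inj₂ p))

∪-lub : {H K L : SG n} → H ⊆ L → K ⊆ L → H ∪ K ⊆ L
∪-lub (hv , he) (kv , ke) = (λ v p → [ hv v , kv v ] (to T-∨ p)) , (λ a b p → [ he a b , ke a b ] (to T-∨ p))

WF-∪ : {H K : SG n} → WF H → WF K → WF (H ∪ K)
WF-∪ {H = H} {K} (symH , irrH , endsH) (symK , irrK , endsK) =
  (λ a b p → from T-∨ (Sum.map (symH a b) (symK a b) (to T-∨ p))) ,
  (λ a p → [ irrH a , irrK a ] (to T-∨ p)) ,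
  (λ a b p → [ lift (∪-⊆ˡ H K) ∘ endsH a b , lift (∪-⊆ʳ H K) ∘ endsK a b ] (to T-∨ p))
  where
  lift : ∀ {L a b} → L ⊆ H ∪ K → T (vs L a) × T (vs L b) → T (vs (H ∪ K) a) × T (vs (H ∪ K) b)
  lift (lv , _) (a∈ , b∈) = lv _ a∈ , lv _ b∈

point : Fin n → SG n
point x = record { vs = λ v → does (v ≟ x) ; es = λ _ _ → false }

-- Its edge relation is literally the one addEdge adds, so addEdge H a b has the edges of H ∪ edgeGraph a b.
edgeGraph : Fin n → Fin n → SG n
edgeGraph a b = record
  { vs = λ v → does (v ≟ a) ∨ does (v ≟ b)
  ; es = λ x y → (does (x ≟ a) ∧ does (y ≟ b)) ∨ (does (x ≟ b) ∧ does (y ≟ a)) }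

module _ (a b : Fin n) where

  edgeGraph-∈ˡ : T (vs (edgeGraph a b) a)
  edgeGraph-∈ˡ = from T-∨ (inj₁ (≟-refl a))

  edgeGraph-∈ʳ : T (vs (edgeGraph a b) b)
  edgeGraph-∈ʳ = from T-∨ (inj₂ (≟-refl b))

  edgeGraph-ab : T (es (edgeGraph a b) a b)
  edgeGraph-ab = from T-∨ (inj₁ (from T-∧ (≟-refl a , ≟-refl b)))

  edgeGraph-ba : T (es (edgeGraph a b) b a)
  edgeGraph-ba = from T-∨ (inj₂ (from T-∧ (≟-refl b , ≟-refl a)))

  edgeGraph-vertex : ∀ x → T (vs (edgeGraph a b) x) → x ≡ a ⊎ x ≡ b
  edgeGraph-vertex x p = Sum.map (fromDoes (x ≟ a)) (fromDoes (x ≟ b)) (to T-∨ p)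

  edgeGraph-edge : ∀ x y → T (es (edgeGraph a b) x y) → (x ≡ a × y ≡ b) ⊎ (x ≡ b × y ≡ a)
  edgeGraph-edge x y p = Sum.map (both (x ≟ a) (y ≟ b)) (both (x ≟ b) (y ≟ a)) (to T-∨ p)
    where
    both : ∀ {P Q : Set} (p? : Dec P) (q? : Dec Q) → T (does p? ∧ does q?) → P × Q
    both p? q? r = let (p , q) = to T-∧ r in fromDoes p? p , fromDoes q? q

WF-edgeGraph : {a b : Fin n} → a ≢ b → WF (edgeGraph a b)
WF-edgeGraph {a = a} {b} a≢b = symmetric , irreflexive , ends
  where
  symmetric : ∀ x y → T (es (edgeGraph a b) x y) → T (es (edgeGraph a b) y x)
  symmetric x y e with edgeGraph-edge a b x y e
  ... | inj₁ (refl , refl) = edgeGraph-ba a b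
  ... | inj₂ (refl , refl) = edgeGraph-ab a b
  irreflexive : ∀ x → ¬ T (es (edgeGraph a b) x x)
  irreflexive x e with edgeGraph-edge a b x x e
  ... | inj₁ (refl , x≡b) = a≢b x≡b
  ... | inj₂ (refl , x≡a) = a≢b (sym x≡a)
  ends : ∀ x y → T (es (edgeGraph a b) x y) → T (vs (edgeGraph a b) x) × T (vs (edgeGraph a b) y)
  ends x y e with edgeGraph-edge a b x y e
  ... | inj₁ (refl , refl) = edgeGraph-∈ˡ a b , edgeGraph-∈ʳ a b
  ... | inj₂ (refl , refl) = edgeGraph-∈ʳ a b , edgeGraph-∈ˡ a b

edgeGraph-⊆ : {H : SG n} {a b : Fin n} → WF H → T (es H a b) → edgeGraph a b ⊆ H
edgeGraph-⊆ {H = H} {a} {b} (symmetric , _ , ends) ab∈H = vertices , edges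
  where
  vertices : ∀ x → T (vs (edgeGraph a b) x) → T (vs H x)
  vertices x x∈ with edgeGraph-vertex a b x x∈
  ... | inj₁ refl = proj₁ (ends a b ab∈H)
  ... | inj₂ refl = proj₂ (ends a b ab∈H)
  edges : ∀ x y → T (es (edgeGraph a b) x y) → T (es H x y)
  edges x y e with edgeGraph-edge a b x y e
  ... | inj₁ (refl , refl) = ab∈H
  ... | inj₂ (refl , refl) = symmetric a b ab∈H

deg-edgeGraph : (a b v : Fin n) → deg (edgeGraph a b) v ≤ 1
deg-edgeGraph a b v =
  countF-≤1 (es (edgeGraph a b) v) (partner (v ≟ a)) λ z e → partner-unique (v ≟ a) (edgeGraph-edge a b v z e)
  where
  partner : Dec (v ≡ a) → Fin _
  partner (yes _) = b
  partner (no _) = a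
  partner-unique : ∀ {z} (v≟a : Dec (v ≡ a)) → (v ≡ a × z ≡ b) ⊎ (v ≡ b × z ≡ a) → z ≡ partner v≟a
  partner-unique (yes _) (inj₁ (_ , z≡b)) = z≡b
  partner-unique (yes v≡a) (inj₂ (v≡b , z≡a)) = trans z≡a (trans (sym v≡a) v≡b)
  partner-unique (no v≢a) (inj₁ (v≡a , _)) = ⊥-elim (v≢a v≡a)
  partner-unique (no _) (inj₂ (_ , z≡a)) = z≡a

edgeGraph-no-edge : {a b v : Fin n} → v ≢ a → v ≢ b → ∀ z → ¬ T (es (edgeGraph a b) v z)
edgeGraph-no-edge {a = a} {b} {v} v≢a v≢b z e = [ v≢a ∘ proj₁ , v≢b ∘ proj₁ ] (edgeGraph-edge a b v z e)

deg-addEdge : (H : SG n) (a b v : Fin n) → deg (addEdge H a b) v ≤ suc (deg H v)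
deg-addEdge H a b v = begin
  deg (addEdge H a b) v                ≤⟨ countF-∨ (es H v) (es (edgeGraph a b) v) ⟩
  deg H v + deg (edgeGraph a b) v      ≤⟨ +-monoʳ-≤ (deg H v) (deg-edgeGraph a b v) ⟩
  deg H v + 1                          ≡⟨ +-comm (deg H v) 1 ⟩
  suc (deg H v)                        ∎
  where open ≤-Reasoning

deg-addEdge-≢ : (H : SG n) {a b v : Fin n} → v ≢ a → v ≢ b → deg (addEdge H a b) v ≤ deg H v
deg-addEdge-≢ H {v = v} v≢a v≢b =
  countF-mono _ _ λ z e → [ id , ⊥-elim ∘ edgeGraph-no-edge v≢a v≢b z ]′ (to (T-∨ {es H v z}) e)

module _ {H : SG n} where

  infixr 5 _++ʷ_

  _++ʷ_ : ∀ {x y z} → Walk H x y → Walk H y z → Walk H x z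
  [] _ ++ʷ W = W
  (e ∷ W₁) ++ʷ W₂ = e ∷ (W₁ ++ʷ W₂)

  source∈ : ∀ {x y} → WF H → Walk H x y → T (vs H x)
  source∈ _ ([] x∈) = x∈
  source∈ (_ , _ , ends) (e ∷ _) = proj₁ (ends _ _ e)

  target∈ : ∀ {x y} → Walk H x y → T (vs H y)
  target∈ ([] y∈) = y∈
  target∈ (_ ∷ W) = target∈ W

  reverseʷ : ∀ {x y} → WF H → Walk H x y → Walk H y x
  reverseʷ _ ([] x∈) = [] x∈
  reverseʷ WH@(symmetric , _ , ends) (e ∷ W) = reverseʷ WH W ++ʷ symmetric _ _ e ∷ [] (proj₁ (ends _ _ e))

mapʷ : {H K : SG n} → H ⊆ K → ∀ {x y} → Walk H x y → Walk K x y
mapʷ (hv , _) ([] x∈) = [] (hv _ x∈)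
mapʷ H⊆K@(_ , he) (e ∷ W) = he _ _ e ∷ mapʷ H⊆K W

connected-fromRoot : {H : SG n} (r : Fin n) → WF H → T (vs H r) → (∀ z → T (vs H z) → Walk H z r) → Connected H
connected-fromRoot r WH r∈ toR = (r , r∈) , λ x y x∈ y∈ → toR x x∈ ++ʷ reverseʷ WH (toR y y∈)

connected-∪ : {H K : SG n} (c : Fin n) → Connected H → Connected K → T (vs H c) → T (vs K c) → Connected (H ∪ K)
connected-∪ {H = H} {K} c (_ , walkH) (_ , walkK) c∈H c∈K =
  (c , from T-∨ (inj₁ c∈H)) , λ x y x∈ y∈ → toC x∈ ++ʷ fromC y∈
  where
  toC : ∀ {x} → T (vs (H ∪ K) x) → Walk (H ∪ K) x c
  toC {x} x∈ = [ (λ p → mapʷ (∪-⊆ˡ H K) (walkH x c p c∈H)) , (λ p → mapʷ (∪-⊆ʳ H K) (walkK x c p c∈K)) ]′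
                  (to T-∨ x∈)
  fromC : ∀ {y} → T (vs (H ∪ K) y) → Walk (H ∪ K) c y
  fromC {y} y∈ = [ (λ p → mapʷ (∪-⊆ˡ H K) (walkH c y c∈H p)) , (λ p → mapʷ (∪-⊆ʳ H K) (walkK c y c∈K p)) ]′
                    (to T-∨ y∈)

connected-edgeGraph : (a b : Fin n) → Connected (edgeGraph a b)
connected-edgeGraph a b = (a , edgeGraph-∈ˡ a b) , λ x y x∈ y∈ → toA x x∈ ++ʷ fromA y y∈
  where
  toA : ∀ x → T (vs (edgeGraph a b) x) → Walk (edgeGraph a b) x a
  toA x x∈ with edgeGraph-vertex a b x x∈
  ... | inj₁ refl = [] (edgeGraph-∈ˡ a b)
  ... | inj₂ refl = edgeGraph-ba a b ∷ [] (edgeGraph-∈ˡ a b)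
  fromA : ∀ y → T (vs (edgeGraph a b) y) → Walk (edgeGraph a b) a y
  fromA y y∈ with edgeGraph-vertex a b y y∈
  ... | inj₁ refl = [] (edgeGraph-∈ˡ a b)
  ... | inj₂ refl = edgeGraph-ab a b ∷ [] (edgeGraph-∈ʳ a b)

component-edge : {D M : SG n} → WF D → IsComponent D M → ∀ {v w} → T (vs M v) → T (es D v w) → T (es M v w)
component-edge {D = D} {M} WD ((WM , M⊆D) , connM , maximal) {v} {w} v∈M vw∈D =
  proj₂ (maximal (M ∪ edgeGraph v w)
                 (WF-∪ WM (WF-edgeGraph (edge-≢ WD vw∈D)) , ∪-lub M⊆D (edgeGraph-⊆ WD vw∈D))
                 (connected-∪ v connM (connected-edgeGraph v w) v∈M (edgeGraph-∈ˡ v w))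
                 (∪-⊆ˡ M (edgeGraph v w)))
        v w (from (T-∨ {es M v w}) (inj₂ (edgeGraph-ab v w)))

deg-component : {G Tg M : SG n} → WF G → IsComponent (delSet G (vs Tg)) M
  → ∀ {v} → T (vs M v) → deg G v ≡ degT G Tg v + deg M v
deg-component {G = G} {Tg} {M} WG comp {v} v∈M =
  trans (countF-split (es G v) (vs Tg)) (cong (degT G Tg v +_) (countF-cong _ (es M v) toM fromM))
  where
  M⊆D : M ⊆ delSet G (vs Tg)
  M⊆D = proj₂ (proj₁ comp)
  v∉T : T (not (vs Tg v))
  v∉T = proj₂ (to (T-∧ {vs G v}) (proj₁ M⊆D v v∈M))
  toM : ∀ w → T (es G v w ∧ not (vs Tg w)) → T (es M v w)
  toM w p = let (vw∈G , w∉T) = to (T-∧ {es G v w}) p in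
    component-edge {D = delSet G (vs Tg)} (WF-delSet (vs Tg) WG) comp v∈M (from T-∧ (vw∈G , from T-∧ (v∉T , w∉T)))
  fromM : ∀ w → T (es M v w) → T (es G v w ∧ not (vs Tg w))
  fromM w vw∈M = let (vw∈G , ends∉T) = to (T-∧ {es G v w}) (proj₂ M⊆D v w vw∈M) in
    from T-∧ (vw∈G , proj₂ (to (T-∧ {not (vs Tg v)}) ends∉T))

-- Traces and paths

module _ {H : SG n} where

  trace : ∀ {x y} → Walk H x y → SG n
  trace ([] {x} _) = point x
  trace (_∷_ {x} {y} _ W) = edgeGraph x y ∪ trace W

  IsPath : ∀ {x y} → Walk H x y → Set
  IsPath ([] _) = ⊤
  IsPath (_∷_ {x} _ W) = ¬ T (vs (trace W) x) × IsPath W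

  source∈trace : ∀ {x y} (W : Walk H x y) → T (vs (trace W) x)
  source∈trace ([] {x} _) = ≟-refl x
  source∈trace (_∷_ {x} {y} _ W) = from T-∨ (inj₁ (edgeGraph-∈ˡ x y))

  target∈trace : ∀ {x y} (W : Walk H x y) → T (vs (trace W) y)
  target∈trace ([] {x} _) = ≟-refl x
  target∈trace {y = w} (_∷_ {x} {y} _ W) = from (T-∨ {vs (edgeGraph x y) w}) (inj₂ (target∈trace W))

  trace-∷-vertex : ∀ {x y w z} (e : T (es H x y)) (W : Walk H y w)
    → T (vs (trace (e ∷ W)) z) → z ≡ x ⊎ T (vs (trace W) z)
  trace-∷-vertex {x} {y} {z = z} e W z∈ with to (T-∨ {vs (edgeGraph x y) z}) z∈
  ... | inj₂ z∈W = inj₂ z∈W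
  ... | inj₁ z∈e with edgeGraph-vertex x y z z∈e
  ...   | inj₁ z≡x = inj₁ z≡x
  ...   | inj₂ refl = inj₂ (source∈trace W)

  walk-in-trace : ∀ {x y} (W : Walk H x y) → Walk (trace W) x y
  walk-in-trace ([] {x} _) = [] (≟-refl x)
  walk-in-trace (_∷_ {x} {y} _ W) =
    from T-∨ (inj₁ (edgeGraph-ab x y)) ∷ mapʷ (∪-⊆ʳ (edgeGraph x y) (trace W)) (walk-in-trace W)

  suffix : ∀ {x y z} (W : Walk H x y) → T (vs (trace W) z)
    → Σ (Walk H z y) λ W′ → (IsPath W → IsPath W′) × trace W′ ⊆ trace W
  suffix {z = z} ([] {x} x∈) z∈ with fromDoes (z ≟ x) z∈
  ... | refl = [] x∈ , id , ⊆-refl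
  suffix (_∷_ {x} {y} e W) z∈ with trace-∷-vertex e W z∈
  ... | inj₁ refl = e ∷ W , id , ⊆-refl
  ... | inj₂ z∈W = let (W′ , keepsPath , W′⊆W) = suffix W z∈W in
    W′ , keepsPath ∘ proj₂ , ⊆-trans W′⊆W (∪-⊆ʳ (edgeGraph x y) (trace W))

  toPath : ∀ {x y} (W : Walk H x y) → Σ (Walk H x y) IsPath
  toPath ([] x∈) = [] x∈ , tt
  toPath (_∷_ {x} e W) with toPath W
  ... | W′ , W′-path with T? (vs (trace W′) x)
  ...   | yes x∈W′ = let (W″ , keepsPath , _) = suffix W′ x∈W′ in W″ , keepsPath W′-path
  ...   | no x∉W′ = e ∷ W′ , x∉W′ , W′-path

module _ {H : SG n} (WH : WF H) where

  trace-⊆ : ∀ {x y} (W : Walk H x y) → trace W ⊆ H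
  trace-⊆ ([] {x} x∈) = (λ v v≟x → subst (T ∘ vs H) (sym (fromDoes (v ≟ x) v≟x)) x∈) , (λ _ _ ())
  trace-⊆ (e ∷ W) = ∪-lub (edgeGraph-⊆ WH e) (trace-⊆ W)

  WF-trace : ∀ {x y} (W : Walk H x y) → WF (trace W)
  WF-trace ([] _) = (λ _ _ ()) , (λ _ ()) , (λ _ _ ())
  WF-trace (e ∷ W) = WF-∪ (WF-edgeGraph (edge-≢ WH e)) (WF-trace W)

  trace-suffix : ∀ {x y z} (W : Walk H x y) → T (vs (trace W) z) → Walk (trace W) z y
  trace-suffix W z∈ = let (W′ , _ , W′⊆W) = suffix W z∈ in mapʷ W′⊆W (walk-in-trace W′)

  connected-trace : ∀ {x y} (W : Walk H x y) → Connected (trace W)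
  connected-trace {y = y} W = connected-fromRoot y (WF-trace W) (target∈trace W) (λ _ → trace-suffix W)

  suffix-avoiding : ∀ {x y z c} (W : Walk H x y) → T (vs (trace W) z) → ¬ T (vs (trace W) c)
    → Walk (delV (trace W) c) z y
  suffix-avoiding W z∈ c∉ = mapʷ (⊆-delV (WF-trace W) c∉) (trace-suffix W z∈)

  -- A path meets c at most once, so one of its two pieces around z avoids c.
  path-split : ∀ {a b z c} (P : Walk H a b) → IsPath P → T (vs (trace P) z) → z ≢ c
    → Walk (delV (trace P) c) z b ⊎ Walk (delV (trace P) c) a z
  path-split {z = z} ([] {x} _) _ z∈ z≢c with fromDoes (z ≟ x) z∈
  ... | refl = inj₁ ([] (delV-∈ (point x) z∈ z≢c))
  path-split {z = z} {c} P@(_∷_ {a} {a′} e P′) (a∉P′ , P′-path) z∈ z≢c with trace-∷-vertex e P′ z∈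
  ... | inj₁ refl = inj₂ ([] (delV-∈ (trace P) z∈ z≢c))
  ... | inj₂ z∈P′ with path-split P′ P′-path z∈P′ z≢c
  ...   | inj₁ z→b = inj₁ (mapʷ (delSet-mono _ (∪-⊆ʳ (edgeGraph a a′) (trace P′))) z→b)
  ...   | inj₂ a′→z with a ≟ c
  ...     | yes refl =
    inj₁ (mapʷ (delSet-mono _ (∪-⊆ʳ (edgeGraph a a′) (trace P′))) (suffix-avoiding P′ z∈P′ a∉P′))
  ...     | no a≢c = inj₂ (delV-edge (trace P) (from T-∨ (inj₁ (edgeGraph-ab a a′))) a≢c a′≢c
                            ∷ mapʷ (delSet-mono _ (∪-⊆ʳ (edgeGraph a a′) (trace P′))) a′→z)
    where
    a′≢c : a′ ≢ c
    a′≢c = delV-≢ (trace P′) (source∈ (WF-delSet _ (WF-trace P′)) a′→z)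

-- Blocks

noCutVertex-fromRoots : {H : SG n} → WF H
  → (∀ c → Σ (Fin n) λ r → ∀ z → T (vs H z) → z ≢ c → ¬ ¬ Walk (delV H c) z r)
  → NoCutVertex H
noCutVertex-fromRoots WH roots c (_ , x , y , x∈ , y∈ , x≢c , y≢c , _ , ¬x→y) =
  let (_ , linked) = roots c in
  linked x x∈ x≢c λ x→r → linked y y∈ y≢c λ y→r → ¬x→y (x→r ++ʷ reverseʷ (WF-delSet _ WH) y→r)

-- NoCutVertex only refutes the absence of a walk, hence the double negations from here on.
block-linked : {B : SG n} → WF B → Connected B → NoCutVertex B
  → ∀ {x y} c → T (vs B x) → T (vs B y) → x ≢ c → y ≢ c → ¬ ¬ Walk (delV B c) x y
block-linked {B = B} WB (_ , walk) noCut c x∈ y∈ x≢c y≢c with T? (vs B c)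
... | yes c∈ = λ ¬x→y → noCut c (c∈ , _ , _ , x∈ , y∈ , x≢c , y≢c , walk _ _ x∈ y∈ , ¬x→y)
... | no c∉ = λ ¬x→y → ¬x→y (mapʷ (⊆-delV WB c∉) (walk _ _ x∈ y∈))

-- Adding to a block B the edge vw and a path from w back to B (or, if B = {v}, nothing else)
-- gives a connected subgraph without cut-vertex, so by maximality vw was already in B.
module Ear {M B : SG n} (WM : WF M) (blk : IsBlock M B) {v w y : Fin n}
           (v∈B : T (vs B v)) (vw∈M : T (es M v w))
           (P : Walk (delV M v) w y) (P-path : IsPath P)
           (anchor : T (vs B y) ⊎ (y ≡ w × (∀ z → T (vs B z) → z ≡ v))) where

  private
    WB : WF B
    WB = proj₁ (proj₁ blk)
    B⊆M : B ⊆ M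
    B⊆M = proj₂ (proj₁ blk)
    connB : Connected B
    connB = proj₁ (proj₂ blk)
    noCutB : NoCutVertex B
    noCutB = proj₁ (proj₂ (proj₂ blk))
    WMv : WF (delV M v)
    WMv = WF-delSet _ WM

    ear B′ : SG _
    ear = edgeGraph v w ∪ trace P
    B′ = B ∪ ear
    WB′ : WF B′
    WB′ = WF-∪ WB (WF-∪ (WF-edgeGraph (edge-≢ WM vw∈M)) (WF-trace WMv P))

    B⊆B′ : B ⊆ B′
    B⊆B′ = ∪-⊆ˡ B ear
    P⊆B′ : trace P ⊆ B′
    P⊆B′ = ⊆-trans (∪-⊆ʳ (edgeGraph v w) (trace P)) (∪-⊆ʳ B ear)

    edge-wv : T (es B′ w v)
    edge-wv = from (T-∨ {es B w v}) (inj₂ (from T-∨ (inj₁ (edgeGraph-ba v w))))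

    vertex-cases : ∀ {z} → T (vs B′ z) → T (vs B z) ⊎ T (vs (trace P) z)
    vertex-cases {z} z∈ with to (T-∨ {vs B z}) z∈
    ... | inj₁ z∈B = inj₁ z∈B
    ... | inj₂ z∈ear with to (T-∨ {vs (edgeGraph v w) z}) z∈ear
    ...   | inj₂ z∈P = inj₂ z∈P
    ...   | inj₁ z∈vw with edgeGraph-vertex v w z z∈vw
    ...     | inj₁ refl = inj₁ v∈B
    ...     | inj₂ refl = inj₂ (source∈trace P)

    B′⊆M : B′ ⊆ M
    B′⊆M = ∪-lub B⊆M (∪-lub (edgeGraph-⊆ WM vw∈M) (⊆-trans (trace-⊆ WMv P) (delSet-⊆ M _)))

    connB′ : Connected B′
    connB′ = connected-∪ v connB (connected-∪ w (connected-edgeGraph v w) (connected-trace WMv P)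
                                                 (edgeGraph-∈ʳ v w) (source∈trace P))
                          v∈B (from T-∨ (inj₁ (edgeGraph-∈ˡ v w)))

    y≢v : y ≢ v
    y≢v = delV-≢ M (target∈ P)

    v∉P : ¬ T (vs (trace P) v)
    v∉P v∈P = delV-≢ M (proj₁ (trace-⊆ WMv P) v v∈P) refl

    w→v-avoiding : ∀ {c} → w ≢ c → v ≢ c → Walk (delV B′ c) w v
    w→v-avoiding w≢c v≢c = delV-edge B′ edge-wv w≢c v≢c ∷ [] (delV-∈ B′ (proj₁ B⊆B′ v v∈B) v≢c)

    linked-in-B : ∀ {x z} c → T (vs B x) → T (vs B z) → x ≢ c → z ≢ c → ¬ ¬ Walk (delV B′ c) x z
    linked-in-B c x∈ z∈ x≢c z≢c =
      ¬¬-map (mapʷ (delSet-mono _ B⊆B′)) (block-linked WB connB noCutB c x∈ z∈ x≢c z≢c)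

    y→v : ∀ {c} → v ≢ c → y ≢ c → ¬ ¬ Walk (delV B′ c) y v
    y→v {c} v≢c y≢c = [ (λ y∈B → linked-in-B c y∈B v∈B y≢c v≢c) , via-edge ]′ anchor
      where
      via-edge : y ≡ w × _ → ¬ ¬ Walk (delV B′ c) y v
      via-edge (y≡w , _) k =
        k (subst (λ q → Walk (delV B′ c) q v) (sym y≡w) (w→v-avoiding (subst (_≢ c) y≡w y≢c) v≢c))

    to-v : ∀ c → v ≢ c → ∀ z → T (vs B′ z) → z ≢ c → ¬ ¬ Walk (delV B′ c) z v
    to-v c v≢c z z∈ z≢c with vertex-cases z∈
    ... | inj₁ z∈B = linked-in-B c z∈B v∈B z≢c v≢c
    ... | inj₂ z∈P with path-split WMv P P-path z∈P z≢c
    ...   | inj₁ z→y =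
      ¬¬-map (mapʷ (delSet-mono _ P⊆B′) z→y ++ʷ_) (y→v v≢c (delV-≢ (trace P) (target∈ z→y)))
    ...   | inj₂ w→z = λ k → k (reverseʷ (WF-delSet _ WB′) (mapʷ (delSet-mono _ P⊆B′) w→z)
                                ++ʷ w→v-avoiding (delV-≢ (trace P) (source∈ (WF-delSet _ (WF-trace WMv P)) w→z)) v≢c)

    to-y : ∀ z → T (vs B′ z) → z ≢ v → ¬ ¬ Walk (delV B′ v) z y
    to-y z z∈ z≢v with vertex-cases z∈
    ... | inj₂ z∈P = λ k → k (mapʷ (delSet-mono _ P⊆B′) (suffix-avoiding WMv P z∈P v∉P))
    ... | inj₁ z∈B =
      [ (λ y∈B → linked-in-B v z∈B y∈B z≢v y≢v) , (λ (_ , only-v) → ⊥-elim (z≢v (only-v z z∈B))) ]′ anchor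

    noCutB′ : NoCutVertex B′
    noCutB′ = noCutVertex-fromRoots WB′ roots
      where
      roots : ∀ c → Σ (Fin _) λ r → ∀ z → T (vs B′ z) → z ≢ c → ¬ ¬ Walk (delV B′ c) z r
      roots c with v ≟ c
      ... | yes refl = y , to-y
      ... | no v≢c = v , to-v c v≢c

  edge∈B : T (es B v w)
  edge∈B = proj₂ (proj₂ (proj₂ (proj₂ blk)) B′ (WB′ , B′⊆M) connB′ noCutB′ B⊆B′) v w
             (from (T-∨ {es B v w}) (inj₂ (from T-∨ (inj₁ (edgeGraph-ab v w)))))

module _ {M B : SG n} (WM : WF M) (blk : IsBlock M B) where

  private
    WB : WF B
    WB = proj₁ (proj₁ blk)
    B⊆M : B ⊆ M
    B⊆M = proj₂ (proj₁ blk)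

  block-edge-via-walk : ∀ {v w y} → T (vs B v) → T (es M v w) → T (vs B y) → Walk (delV M v) w y → T (es B v w)
  block-edge-via-walk v∈B vw∈M y∈B W = let (P , P-path) = toPath W in Ear.edge∈B WM blk v∈B vw∈M P P-path (inj₁ y∈B)

  exit⇒cutVertex : ∀ {a a′} → T (vs B a) → T (es M a a′) → ¬ T (vs B a′) → IsCutVertex M a
  exit⇒cutVertex {a} {a′} a∈B aa′∈M a′∉B with any? (λ y → T? (vs B y) ×-dec ¬? (y ≟ a))
  ... | yes (y , y∈B , y≢a) =
    proj₁ B⊆M a a∈B , a′ , y , edge-target∈ WM aa′∈M , proj₁ B⊆M y y∈B , a′≢a , y≢a ,
    proj₁ WM a a′ aa′∈M ∷ mapʷ B⊆M (proj₂ (proj₁ (proj₂ blk)) a y a∈B y∈B) ,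
    λ W → a′∉B (edge-target∈ WB (block-edge-via-walk a∈B aa′∈M y∈B W))
    where
    a′≢a : a′ ≢ a
    a′≢a = edge-≢ WM aa′∈M ∘ sym
  -- Otherwise B = {a}, and the ear is the edge aa′ alone.
  ... | no no-other = ⊥-elim (a′∉B (edge-target∈ WB
          (Ear.edge∈B WM blk a∈B aa′∈M ([] (delV-∈ M (edge-target∈ WM aa′∈M) (edge-≢ WM aa′∈M ∘ sym))) tt
                      (inj₂ (refl , λ z z∈B → decidable-stable (z ≟ a) λ z≢a → no-other (z , z∈B , z≢a))))))

  interior-edge : ∀ {v w} → Interior M B v → T (es M v w) → T (es B v w)
  interior-edge {v} {w} (v∈B , not-cut) vw∈M with T? (vs B w)
  ... | yes w∈B = block-edge-via-walk v∈B vw∈M w∈B ([] (delV-∈ M (proj₁ B⊆M w w∈B) (edge-≢ WM vw∈M ∘ sym)))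
  ... | no w∉B = ⊥-elim (not-cut (exit⇒cutVertex v∈B vw∈M w∉B))

  deg-interior : ∀ {v} → Interior M B v → deg B v ≡ deg M v
  deg-interior {v} v-int = countF-cong (es B v) (es M v) (proj₂ B⊆M v) (λ w → interior-edge v-int)

exit-edge : {M : SG n} (B : SG n) → ∀ {p q} → Walk M p q → T (vs B p) → ¬ T (vs B q)
  → ∃₂ λ a a′ → T (vs B a) × T (es M a a′) × ¬ T (vs B a′)
exit-edge B ([] _) p∈B q∉B = ⊥-elim (q∉B p∈B)
exit-edge B (_∷_ {x} {y} e W) x∈B q∉B with T? (vs B y)
... | yes y∈B = exit-edge B W y∈B q∉B
... | no y∉B = x , y , x∈B , e , y∉B

noCutVertex-of-2connected : {M : SG n} → KConnected 2 M → NoCutVertex M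
noCutVertex-of-2connected {M = M} (_ , connected) c (_ , x , y , x∈ , y∈ , x≢c , y≢c , _ , ¬x→y) =
  ¬x→y (proj₂ (connected _ (s≤s (≤-reflexive (countF-≟ c)))) x y (delV-∈ M x∈ x≢c) (delV-∈ M y∈ y≢c))

endBlock-of-≅ : {M B : SG n} → WF M → Connected M → NoCutVertex M → B ≅ M → IsEndBlock M B
endBlock-of-≅ {M = M} {B} WM ((r , r∈M) , walkM) noCutM B≅M@(B⊆M , M⊆B) =
  ((WF-≅ B≅M WM , B⊆M) , connB , noCutB , λ _ (_ , B′⊆M) _ _ _ → ⊆-trans B′⊆M M⊆B) ,
  λ a _ _ a-cut _ _ → ⊥-elim (noCutM a a-cut)
  where
  connB : Connected B
  connB = (r , proj₁ M⊆B r r∈M) , λ x y x∈ y∈ → mapʷ M⊆B (walkM x y (proj₁ B⊆M x x∈) (proj₁ B⊆M y y∈))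
  noCutB : NoCutVertex B
  noCutB c (c∈ , x , y , x∈ , y∈ , x≢c , y≢c , x→y , ¬x→y) =
    noCutM c (proj₁ B⊆M c c∈ , x , y , proj₁ B⊆M x x∈ , proj₁ B⊆M y y∈ , x≢c , y≢c , mapʷ B⊆M x→y ,
              ¬x→y ∘ mapʷ (delSet-mono _ M⊆B))

AllInterior : SG n → SG n → Set
AllInterior M B = ∀ v → T (vs M v) → Interior M B v

endBlock-of-choice : {M B : SG n} {X : Set} → WF M → Connected M
  → (KConnected 2 M × B ≅ M) ⊎ (IsEndBlock M B × X)
  → IsEndBlock M B × (AllInterior M B ⊎ X)
endBlock-of-choice WM connM (inj₁ (2-conn , B≅M)) =
  endBlock-of-≅ WM connM noCut B≅M , inj₁ (λ v v∈M → proj₁ (proj₂ B≅M) v v∈M , noCut v)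
  where
  noCut : NoCutVertex _
  noCut = noCutVertex-of-2connected 2-conn
endBlock-of-choice _ _ (inj₂ (endBlock , x)) = endBlock , inj₂ x

-- Valid pairs

AtMostOne : (Fin n → Set) → Set
AtMostOne P = ∀ v v′ → P v → P v′ → v ≡ v′

allButOne : {P Q : Fin n → Set} → Fin n → Decidable P → Decidable Q
  → AtMostOne (λ v → P v × ¬ Q v) → AllButOne P Q
allButOne d P? Q? unique with any? (λ v → P? v ×-dec ¬? (Q? v))
... | yes (e , Pe , ¬Qe) = e , λ v Pv v≢e → decidable-stable (Q? v) λ ¬Qv → v≢e (unique v e (Pv , ¬Qv) (Pe , ¬Qe))
... | no none = d , λ v Pv _ → decidable-stable (Q? v) λ ¬Qv → none (v , Pv , ¬Qv)

Deficient : ℕ → SG n → Fin n → Fin n → Set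
Deficient t B u v = T (vs B v) × v ≢ u × ¬ t ≤ deg B v

allButOne-sufficient : {B : SG n} {t : ℕ} {u : Fin n} → AtMostOne (Deficient t B u)
  → ∀ z → AllButOne (λ v → T (vs B v) × v ≢ u × v ≢ z) (λ v → t ≤ deg B v)
allButOne-sufficient {B = B} {t} {u} unique z =
  allButOne u (λ v → T? (vs B v) ×-dec ¬? (v ≟ u) ×-dec ¬? (v ≟ z)) (λ v → t ≤? deg B v)
    λ v v′ ((v∈ , v≢u , _) , low) ((v′∈ , v′≢u , _) , low′) →
      unique v v′ (v∈ , v≢u , low) (v′∈ , v′≢u , low′)

-- The hypothesis leaves only cut-vertices of M deficient, and an end-block contains at most one.
atMostOne-deficient-cut : {M B : SG n} {t : ℕ} {u : Fin n} → IsEndBlock M B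
  → (∀ v → Interior M B v → ¬ Deficient t B u v) → AtMostOne (Deficient t B u)
atMostOne-deficient-cut endBlock no-interior v v′ v-def@(v∈B , _) v′-def@(v′∈B , _) =
  decidable-stable (v ≟ v′) λ v≢v′ →
    no-interior v (v∈B , λ v-cut →
      no-interior v′ (v′∈B , λ v′-cut → v≢v′ (proj₂ endBlock v v′ v∈B v-cut v′∈B v′-cut)) v′-def) v-def

valid-of-endBlock : {M B : SG n} {t : ℕ} {u : Fin n} → WF M → Connected M → IsEndBlock M B
  → Interior M B u → t ≤ order B → AtMostOne (Deficient t B u)
  → ∀ x → T (vs M x) → x ≢ u → Valid t M u x
valid-of-endBlock {M = M} {B} {t} {u} WM (_ , walkM) endBlock (u∈B , u-not-cut) t≤|B| unique x x∈M _
  with T? (vs B x)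
... | yes x∈B = B , endBlock , t≤|B| , inj₁ (u∈B , x∈B , allButOne-sufficient unique x)
... | no x∉B with exit-edge B (walkM u x (proj₁ (proj₂ (proj₁ (proj₁ endBlock))) u u∈B) x∈M) u∈B x∉B
...   | b , b′ , b∈B , bb′∈M , b′∉B =
  B , endBlock , t≤|B| ,
  inj₂ (b , (b∈B , b-cut , λ c c∈B c-cut → proj₂ endBlock c b c∈B c-cut b∈B b-cut) ,
        u∈B , u≢b , x∉B , allButOne-sufficient unique b)
  where
  b-cut : IsCutVertex M b
  b-cut = exit⇒cutVertex WM (proj₁ endBlock) b∈B bb′∈M b′∉B
  u≢b : u ≢ b
  u≢b refl = u-not-cut b-cut

OneOf : Fin n → Fin n → Fin n → Set
OneOf a b v = v ≡ a ⊎ v ≡ b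

oneOf-pigeonhole : {a b x y z : Fin n} → OneOf a b x → OneOf a b y → OneOf a b z → x ≢ z → y ≢ z → x ≡ y
oneOf-pigeonhole (inj₁ refl) (inj₁ refl) _ _ _ = refl
oneOf-pigeonhole (inj₂ refl) (inj₂ refl) _ _ _ = refl
oneOf-pigeonhole (inj₁ refl) (inj₂ refl) (inj₁ refl) x≢z _ = ⊥-elim (x≢z refl)
oneOf-pigeonhole (inj₁ refl) (inj₂ refl) (inj₂ refl) _ y≢z = ⊥-elim (y≢z refl)
oneOf-pigeonhole (inj₂ refl) (inj₁ refl) (inj₁ refl) _ y≢z = ⊥-elim (y≢z refl)
oneOf-pigeonhole (inj₂ refl) (inj₁ refl) (inj₂ refl) x≢z _ = ⊥-elim (x≢z refl)

oneOf-cover : {a b x y : Fin n} (P : Fin n → Set) → OneOf a b x → OneOf a b y → x ≢ y → P x → P y → P a × P b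
oneOf-cover _ (inj₁ refl) (inj₂ refl) _ Px Py = Px , Py
oneOf-cover _ (inj₂ refl) (inj₁ refl) _ Px Py = Py , Px
oneOf-cover _ (inj₁ refl) (inj₁ refl) x≢y _ _ = ⊥-elim (x≢y refl)
oneOf-cover _ (inj₂ refl) (inj₂ refl) x≢y _ _ = ⊥-elim (x≢y refl)

-- Degree bounds in B_M

module Degrees {k : ℕ} {G Tg M B : SG n} {u : Fin n}
  (WG : WF G) (comp : IsComponent (delSet G (vs Tg)) M) (endBlock : IsEndBlock M B)
  (uc : UMChoice G Tg M B u) (U≤k : degT G Tg u ≤ k) where

  private
    U t : ℕ
    U = degT G Tg u
    t = k ∸ U

    U+t≡k : U + t ≡ k
    U+t≡k = m+[n∸m]≡n U≤k

    WM : WF M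
    WM = proj₁ (proj₁ comp)
    WB : WF B
    WB = proj₁ (proj₁ (proj₁ endBlock))
    B⊆M : B ⊆ M
    B⊆M = proj₂ (proj₁ (proj₁ endBlock))
    u-int : Interior M B u
    u-int = proj₁ uc
    U-max : ∀ v → Interior M B v → degT G Tg v ≤ U
    U-max = proj₁ (proj₂ uc)

    interior∈G : ∀ {v} → Interior M B v → T (vs G v)
    interior∈G {v} (v∈B , _) = proj₁ (to (T-∧ {vs G v}) (proj₁ (proj₂ (proj₁ comp)) v (proj₁ B⊆M v v∈B)))

    deg-split : ∀ {v} → Interior M B v → deg G v ≡ degT G Tg v + deg B v
    deg-split {v} v-int@(v∈B , _) =
      trans (deg-component {Tg = Tg} WG comp (proj₁ B⊆M v v∈B))
            (cong (degT G Tg v +_) (sym (deg-interior WM (proj₁ endBlock) v-int)))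

    -- d ∈ {0, 1} is the slack allowed in the degree of v.
    sufficient : ∀ d {v} → Interior M B v → k ≤ d + deg G v → t ≤ d + deg B v
    sufficient d {v} v-int k≤ = +-cancelˡ-≤ U t (d + deg B v) (begin
      U + t                         ≡⟨ U+t≡k ⟩
      k                             ≤⟨ k≤ ⟩
      d + deg G v                   ≡⟨ cong (d +_) (deg-split v-int) ⟩
      d + (degT G Tg v + deg B v)   ≡⟨ x∙yz≈y∙xz d (degT G Tg v) (deg B v) ⟩
      degT G Tg v + (d + deg B v)   ≤⟨ +-monoˡ-≤ (d + deg B v) (U-max v v-int) ⟩
      U + (d + deg B v)             ∎)
      where open ≤-Reasoning

    deficient⇒low : ∀ {v} → Interior M B v → deg B v < t → deg G v < k
    deficient⇒low {v} v-int deficient = begin-strict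
      deg G v                   ≡⟨ deg-split v-int ⟩
      degT G Tg v + deg B v     <⟨ +-mono-≤-< (U-max v v-int) deficient ⟩
      U + t                     ≡⟨ U+t≡k ⟩
      k                         ∎
      where open ≤-Reasoning

    -- A deficient v of degree ≥ k - 1 has deg_T v = U, so the tie-break in the choice of u applies.
    deficient⇒tie : ∀ {v} → Interior M B v → deg B v < t → k ≤ suc (deg G v) → deg G u ≤ deg G v
    deficient⇒tie {v} v-int deficient k≤ = proj₂ (proj₂ uc) v v-int (≤-antisym (U-max v v-int) U≤)
      where
      open ≤-Reasoning
      U≤ : U ≤ degT G Tg v
      U≤ = +-cancelʳ-≤ (suc (deg B v)) U (degT G Tg v) (begin
        U + suc (deg B v)          ≤⟨ +-monoʳ-≤ U deficient ⟩
        U + t                      ≡⟨ U+t≡k ⟩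
        k                          ≤⟨ k≤ ⟩
        suc (deg G v)              ≡⟨ cong suc (deg-split v-int) ⟩
        suc (degT G Tg v + deg B v) ≡⟨ sym (+-suc (degT G Tg v) (deg B v)) ⟩
        degT G Tg v + suc (deg B v) ∎)

    order-bound : ∀ {v} → Interior M B v → t ≤ suc (deg B v) → t ≤ order B
    order-bound (v∈B , _) t≤ = ≤-trans t≤ (deg<order B WB v∈B)

  module TypeI (θ : Fin n) (high : ∀ v → T (vs G v) → v ≢ θ → k ≤ deg G v) where

    private
      sufficient-I : ∀ {v} → Interior M B v → v ≢ θ → t ≤ deg B v
      sufficient-I {v} v-int v≢θ = sufficient 0 v-int (high v (interior∈G v-int) v≢θ)

      deficient⇒θ : ∀ {v} → Interior M B v → ¬ t ≤ deg B v → v ≡ θ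
      deficient⇒θ {v} v-int low = decidable-stable (v ≟ θ) λ v≢θ → low (sufficient-I v-int v≢θ)

      order-bound-I : ∀ {v} → Interior M B v → v ≢ θ → t ≤ order B
      order-bound-I v-int v≢θ = order-bound v-int (m≤n⇒m≤1+n (sufficient-I v-int v≢θ))

    valid : AllInterior M B ⊎ ¬ Interior M B θ
      → ∀ x → T (vs M x) → x ≢ u → Valid t M u x
    valid choice x x∈M x≢u =
      valid-of-endBlock WM (proj₁ (proj₂ comp)) endBlock u-int (large choice) (atMostOne choice) x x∈M x≢u
      where
      large : AllInterior M B ⊎ ¬ Interior M B θ → t ≤ order B
      large (inj₂ θ-not-int) = order-bound-I u-int λ u≡θ → θ-not-int (subst (Interior M B) u≡θ u-int)
      large (inj₁ all-int) with u ≟ θ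
      ... | no u≢θ = order-bound-I u-int u≢θ
      ... | yes u≡θ = order-bound-I (all-int x x∈M) λ x≡θ → x≢u (trans x≡θ (sym u≡θ))
      atMostOne : AllInterior M B ⊎ ¬ Interior M B θ → AtMostOne (Deficient t B u)
      atMostOne (inj₁ all-int) v v′ (v∈B , _ , low) (v′∈B , _ , low′) =
        trans (deficient⇒θ (all-int v (proj₁ B⊆M v v∈B)) low)
              (sym (deficient⇒θ (all-int v′ (proj₁ B⊆M v′ v′∈B)) low′))
      atMostOne (inj₂ θ-not-int) = atMostOne-deficient-cut endBlock λ v v-int (_ , _ , low) →
        θ-not-int (subst (Interior M B) (deficient⇒θ v-int low) v-int)

  module TypeII (θ₁ θ₂ : Fin n) (high : ∀ v → T (vs G v) → v ≢ θ₁ → v ≢ θ₂ → k ≤ deg G v)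
                (near : ∀ v → T (vs G v) → k ≤ suc (deg G v)) where

    private
      low⇒oneOf : ∀ {v} → T (vs G v) → deg G v < k → OneOf θ₁ θ₂ v
      low⇒oneOf {v} v∈G low with v ≟ θ₁ | v ≟ θ₂
      ... | yes v≡θ₁ | _ = inj₁ v≡θ₁
      ... | no _ | yes v≡θ₂ = inj₂ v≡θ₂
      ... | no v≢θ₁ | no v≢θ₂ = ⊥-elim (<⇒≱ low (high v v∈G v≢θ₁ v≢θ₂))

      deficient⇒oneOf : ∀ {v} → Interior M B v → ¬ t ≤ deg B v → OneOf θ₁ θ₂ v × OneOf θ₁ θ₂ u
      deficient⇒oneOf {v} v-int low =
        low⇒oneOf (interior∈G v-int) v-low ,
        low⇒oneOf (interior∈G u-int) (≤-<-trans (deficient⇒tie v-int (≰⇒> low) (near v (interior∈G v-int))) v-low)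
        where
        v-low : deg G v < k
        v-low = deficient⇒low v-int (≰⇒> low)

    valid : AllInterior M B ⊎ ¬ (Interior M B θ₁ × Interior M B θ₂)
      → ∀ x → T (vs M x) → x ≢ u → Valid t M u x
    valid choice =
      valid-of-endBlock WM (proj₁ (proj₂ comp)) endBlock u-int
        (order-bound u-int (sufficient 1 u-int (near u (interior∈G u-int)))) (atMostOne choice)
      where
      atMostOne : AllInterior M B ⊎ ¬ (Interior M B θ₁ × Interior M B θ₂)
        → AtMostOne (Deficient t B u)
      atMostOne (inj₁ all-int) v v′ (v∈B , v≢u , low) (v′∈B , v′≢u , low′) =
        let (v-oneOf , u-oneOf) = deficient⇒oneOf (all-int v (proj₁ B⊆M v v∈B)) low in
        oneOf-pigeonhole v-oneOf (proj₁ (deficient⇒oneOf (all-int v′ (proj₁ B⊆M v′ v′∈B)) low′))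
                         u-oneOf v≢u v′≢u
      atMostOne (inj₂ not-both) = atMostOne-deficient-cut endBlock λ v v-int (_ , v≢u , low) →
        let (v-oneOf , u-oneOf) = deficient⇒oneOf v-int low in
        not-both (oneOf-cover (Interior M B) v-oneOf u-oneOf v≢u v-int u-int)

mainTheorem13 : ∀ {n : ℕ} (k : ℕ) → 6 ≤ k
    → (Gs G : SG n) → WF Gs → (w : KWeak k Gs G)
    → (Tg : SG n) → IsSubgraph Tg G
    → (M : SG n) → IsComponent (delSet G (vs Tg)) M → 3 ≤ order M
    → (B : SG n) → BMChoice w M B
    → (u : Fin n) → UMChoice G Tg M B u
    → degT G Tg u ≤ k ∸ 2
    → ∀ (x : Fin n) → T (vs M x) → x ≢ u
    → Valid (k ∸ degT G Tg u) M u x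
mainTheorem13 k _ Gs _ WGs (typeI θ _ second-deg θ∈ θ-min) Tg _ M comp _ B choice u uc U≤ =
  TypeI.valid θ high (proj₂ chosen)
  where
  chosen : IsEndBlock M B × (AllInterior M B ⊎ ¬ Interior M B θ)
  chosen = endBlock-of-choice (proj₁ (proj₁ comp)) (proj₁ (proj₂ comp)) (Sum.map₂ proj₂ choice)
  open Degrees {k = k} {Gs} {Tg} {M} {B} {u} WGs comp (proj₁ chosen) uc (≤-trans U≤ (m∸n≤m k 2))
  high : ∀ v → T (vs Gs v) → v ≢ θ → k ≤ deg Gs v
  high v v∈ v≢θ = [ id , (λ k≤θ → ≤-trans k≤θ (θ-min v v∈)) ]′ (second-deg v θ v∈ θ∈ v≢θ)
mainTheorem13 k _ Gs _ WGs (typeII θ θ₁ θ₂ _ _ _ _ _ _ _ min-deg) Tg _ M comp _ B choice u uc U≤ =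
  TypeII.valid θ₁ θ₂ high near (proj₂ chosen)
  where
  G : SG _
  G = delV Gs θ
  chosen : IsEndBlock M B × (AllInterior M B ⊎ ¬ (Interior M B θ₁ × Interior M B θ₂))
  chosen = endBlock-of-choice (proj₁ (proj₁ comp)) (proj₁ (proj₂ comp)) (Sum.map₂ (proj₁ ∘ proj₂) choice)
  open Degrees {k = k} {G} {Tg} {M} {B} {u} (WF-delSet _ WGs) comp (proj₁ chosen) uc (≤-trans U≤ (m∸n≤m k 2))
  high : ∀ v → T (vs G v) → v ≢ θ₁ → v ≢ θ₂ → k ≤ deg G v
  high v v∈ v≢θ₁ v≢θ₂ = ≤-trans (min-deg v v∈) (deg-addEdge-≢ G v≢θ₁ v≢θ₂)
  near : ∀ v → T (vs G v) → k ≤ suc (deg G v)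
  near v v∈ = ≤-trans (min-deg v v∈) (deg-addEdge G θ₁ θ₂ v)
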